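{- For $w\in\mathcal I_n$, the matrix $\Phi(w)$ belongs to $\mathrm{Mono}_n$ if and only if $w$ is non-decreasing. Thus, under the bijection $\Phi$ between $\mathcal I_n$ and $\mathrm{Par}_n$, the matrices in $\mathrm{Mono}_n$ correspond exactly to the non-decreasing inversion tables.
   Context: $[a,b]=\{i\in\mathbb Z:a\le i\le b\}$. $\mathcal I_n$ is the set of integer sequences $(x_1,\dots,x_n)$ with $0\le x_\ell\le \ell-1$; such a sequence is non-decreasing if $x_i\le x_{i+1}$ for $1\le i<n$. A partition matrix on $[1,n]$ is a square upper triangular matrix whose entries are subsets of $[1,n]$ such that: (i) every row and column contains a non-empty entry; (ii) the non-empty entries partition $[1,n]$; (iii) $\mathrm{col}(i)<\mathrm{col}(j)$ implies $i<j$, where $\mathrm{col}(i)$ and $\mathrm{row}(i)$ are the column and row indices of the entry containing $i$. $\mathrm{Par}_n$ is the set of these, and $\mathrm{Mono}_n$ is the set of $A\in\mathrm{Par}_n$ which also satisfy (iv) $\mathrm{row}(i)<\mathrm{row}(j)$ implies $i<j$. For $w=(x_1,\dots,x_n)\in\mathcal I_n$ with set of distinct entries $\{y_1<\dots<y_k\}$ and $y_{k+1}:=n$, $\Phi(w)$ is the $k\times k$ matrix whose $(i,j)$ entry is $\{\ell\in[1,n]: x_\ell=y_i\text{ and }y_j<\ell\le y_{j+1}\}$; $\Phi$ is a bijection $\mathcal I_n\to\mathrm{Par}_n$. -}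

module Defs where

open import Data.Nat using (ℕ; zero; suc; _≤_; _<_; _≟_; _<?_; _≤?_)
open import Data.Fin using (Fin; toℕ)
open import Data.Fin.Subset using (Subset; _∈_; ⊥; Nonempty)
open import Data.List using (List; []; _∷_; filter; upTo; length; lookup)
open import Data.Vec using (tabulate)
open import Data.Bool using (Bool; _∧_)
open import Data.Product using (_×_; ∃; ∃₂)
open import Relation.Binary.PropositionalEquality using (_≡_)
open import Relation.Nullary.Decidable using (⌊_⌋)
open import Data.Fin.Properties using (any?)

-- Convention: an element ℓ ∈ [1,n] is represented by m : Fin n with ℓ = toℕ m + 1.
-- A sequence (x_1,…,x_n) is w : Fin n → ℕ with x_ℓ = w m (ℓ = toℕ m + 1).

InversionTable : {n : ℕ} → (Fin n → ℕ) → Set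
InversionTable {n} w = (m : Fin n) → w m ≤ toℕ m

NonDecreasing : {n : ℕ} → (Fin n → ℕ) → Set
NonDecreasing {n} w = (i j : Fin n) → toℕ j ≡ suc (toℕ i) → w i ≤ w j

Matrix : ℕ → ℕ → Set
Matrix k n = Fin k → Fin k → Subset n

module _ {k n : ℕ} (M : Matrix k n) where

  UpperTriangular : Set
  UpperTriangular = (r c : Fin k) → toℕ c < toℕ r → M r c ≡ ⊥

  RowsColsNonempty : Set
  RowsColsNonempty =
    ((r : Fin k) → ∃ λ c → Nonempty (M r c)) ×
    ((c : Fin k) → ∃ λ r → Nonempty (M r c))

  Partitions : Set
  Partitions =
    ((ℓ : Fin n) → ∃₂ λ r c → ℓ ∈ M r c) ×
    ((ℓ : Fin n) (r c r' c' : Fin k) → ℓ ∈ M r c → ℓ ∈ M r' c' →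
       (r ≡ r') × (c ≡ c'))

  ColMonotone : Set
  ColMonotone = (i j : Fin n) (r c r' c' : Fin k) → i ∈ M r c → j ∈ M r' c' →
    toℕ c < toℕ c' → toℕ i < toℕ j

  RowMonotone : Set
  RowMonotone = (i j : Fin n) (r c r' c' : Fin k) → i ∈ M r c → j ∈ M r' c' →
    toℕ r < toℕ r' → toℕ i < toℕ j

  IsPartitionMatrix : Set
  IsPartitionMatrix = UpperTriangular × RowsColsNonempty × Partitions × ColMonotone

  IsMono : Set
  IsMono = IsPartitionMatrix × RowMonotone

-- The distinct entries y_1 < … < y_k of w, in increasing order
-- (all entries of an inversion table lie in [0, n-1]).
distinctEntries : {n : ℕ} → (Fin n → ℕ) → List ℕ
distinctEntries {n} w = filter (λ v → any? (λ m → w m ≟ v)) (upTo n)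

numDistinct : {n : ℕ} → (Fin n → ℕ) → ℕ
numDistinct w = length (distinctEntries w)

-- nth with a default value (used for y_{k+1} := n)
nthOr : ℕ → List ℕ → ℕ → ℕ
nthOr d []       _       = d
nthOr d (x ∷ xs) zero    = x
nthOr d (x ∷ xs) (suc i) = nthOr d xs i

-- y_i for i ∈ Fin k (0-based index)
yval : {n : ℕ} (w : Fin n → ℕ) → Fin (numDistinct w) → ℕ
yval w i = lookup (distinctEntries w) i

ynext : {n : ℕ} (w : Fin n → ℕ) → Fin (numDistinct w) → ℕ
ynext {n} w i = nthOr n (distinctEntries w) (suc (toℕ i))

Φ : {n : ℕ} (w : Fin n → ℕ) → Matrix (numDistinct w) n
Φ w i j = tabulate λ m →
  ⌊ w m ≟ yval w i ⌋ ∧ ⌊ yval w j <? suc (toℕ m) ⌋ ∧ ⌊ suc (toℕ m) ≤? ynext w j ⌋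

module Submission where

open import Defs
open import Data.Nat using (ℕ; zero; suc; _+_; _∸_; _≤_; _<_; _≟_; _<?_; _≤?_; z≤n; s≤s)
open import Data.Nat.Properties
open import Data.Fin using (Fin; toℕ; fromℕ<) renaming (zero to fzero; suc to fsuc)
open import Data.Fin.Properties using (toℕ<n; toℕ-injective; toℕ-fromℕ<; any?)
open import Data.Fin.Subset using (_∈_; Nonempty)
open import Data.Fin.Subset.Properties using (Empty-unique)
open import Data.List using (List; []; _∷_; upTo; length; lookup)
open import Data.List.Relation.Unary.All as All using (All; []; _∷_)
open import Data.List.Relation.Unary.All.Properties using (all-upTo)
  renaming (filter⁺ to All-filter⁺)
open import Data.List.Relation.Unary.AllPairs using (AllPairs; []; _∷_)
import Data.List.Relation.Unary.AllPairs.Properties as AllPairs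
import Data.List.Relation.Unary.Any as Any
open import Data.List.Relation.Unary.Any.Properties using (lookup-index)
import Data.List.Membership.Propositional as List
open import Data.List.Membership.Propositional.Properties
  using (∈-filter⁺; ∈-filter⁻; ∈-upTo⁺; ∈-lookup)
open import Data.Vec.Properties using (lookup∘tabulate; []=⇒lookup; lookup⇒[]=)
open import Data.Bool using (true; _∧_)
open import Data.Product using (_×_; _,_; ∃; proj₁; proj₂)
open import Data.Sum using (inj₁; inj₂)
open import Data.Empty using (⊥; ⊥-elim)
open import Relation.Nullary using (Dec; yes; no)
open import Relation.Nullary.Decidable using (⌊_⌋)
open import Relation.Binary.PropositionalEquality
open import Relation.Binary.Definitions using (tri<; tri≈; tri>)
open import Function using (id)
open import Function.Bundles using (_⇔_; mk⇔; module Equivalence)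

Increasing : List ℕ → Set
Increasing = AllPairs _<_

lookup-strict : ∀ {L} → Increasing L → (i j : Fin (length L)) →
  toℕ i < toℕ j → lookup L i < lookup L j
lookup-strict (x<rest ∷ _) fzero (fsuc j) _ = All.lookup x<rest (∈-lookup j)
lookup-strict (_ ∷ inc) (fsuc i) (fsuc j) (s≤s i<j) = lookup-strict inc i j i<j

lookup-mono : ∀ {L} → Increasing L → (i j : Fin (length L)) →
  toℕ i ≤ toℕ j → lookup L i ≤ lookup L j
lookup-mono {L} inc i j i≤j with m≤n⇒m<n∨m≡n i≤j
... | inj₁ i<j = <⇒≤ (lookup-strict inc i j i<j)
... | inj₂ i≡j = ≤-reflexive (cong (lookup L) (toℕ-injective i≡j))

lookup-reflects-< : ∀ {L} → Increasing L → (i j : Fin (length L)) →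
  lookup L i < lookup L j → toℕ i < toℕ j
lookup-reflects-< {L} inc i j yi<yj with <-cmp (toℕ i) (toℕ j)
... | tri< i<j _ _ = i<j
... | tri≈ _ i≡j _ = ⊥-elim (<-irrefl (cong (lookup L) (toℕ-injective i≡j)) yi<yj)
... | tri> _ _ j<i = ⊥-elim (<-asym yi<yj (lookup-strict inc j i j<i))

lookup-injective : ∀ {L} → Increasing L → (i j : Fin (length L)) →
  lookup L i ≡ lookup L j → i ≡ j
lookup-injective inc i j yi≡yj with <-cmp (toℕ i) (toℕ j)
... | tri< i<j _ _ = ⊥-elim (<-irrefl yi≡yj (lookup-strict inc i j i<j))
... | tri≈ _ i≡j _ = toℕ-injective i≡j
... | tri> _ _ j<i = ⊥-elim (<-irrefl (sym yi≡yj) (lookup-strict inc j i j<i))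

-- The entries y₀ < y₁ < … of L, followed by the sentinel d, delimit the
-- blocks [y_c, y_{c+1}).  In Φ(w) the sentinel is n, and the column of ℓ is
-- the block containing ℓ - 1.

next : ℕ → (L : List ℕ) → Fin (length L) → ℕ
next d L c = nthOr d L (suc (toℕ c))

InBlock : ℕ → (L : List ℕ) → Fin (length L) → ℕ → Set
InBlock d L c x = lookup L c ≤ x × x < next d L c

lookup<next : ∀ {d L} → Increasing L → All (_< d) L → (c : Fin (length L)) →
  lookup L c < next d L c
lookup<next {L = _ ∷ []}    _                 (x<d ∷ _)  fzero    = x<d
lookup<next {L = _ ∷ _ ∷ _} ((x<y ∷ _) ∷ _)  _          fzero    = x<y
lookup<next                  (_ ∷ inc)        (_ ∷ <d)   (fsuc c) = lookup<next inc <d c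

next≤lookup : ∀ {d L} → Increasing L → (c c' : Fin (length L)) →
  toℕ c < toℕ c' → next d L c ≤ lookup L c'
next≤lookup {L = _ ∷ _ ∷ _} (_ ∷ inc) fzero    (fsuc c') _          = lookup-mono inc fzero c' z≤n
next≤lookup                  (_ ∷ inc) (fsuc c) (fsuc c') (s≤s c<c') = next≤lookup inc c c' c<c'

nthOr≤sentinel : ∀ {d L} → All (_< d) L → ∀ k → nthOr d L k ≤ d
nthOr≤sentinel []         _       = ≤-refl
nthOr≤sentinel (x<d ∷ _)  zero    = <⇒≤ x<d
nthOr≤sentinel (_ ∷ <d)   (suc k) = nthOr≤sentinel <d k

blocks-ordered : ∀ {d L} → Increasing L → (c c' : Fin (length L)) {x x' : ℕ} →
  x < next d L c → lookup L c' ≤ x' → toℕ c < toℕ c' → x < x'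
blocks-ordered inc c c' x<end start≤x' c<c' =
  <-≤-trans x<end (≤-trans (next≤lookup inc c c' c<c') start≤x')

block-unique : ∀ {d L} → Increasing L → (c c' : Fin (length L)) {x : ℕ} →
  InBlock d L c x → InBlock d L c' x → c ≡ c'
block-unique inc c c' (start , end) (start' , end') with <-cmp (toℕ c) (toℕ c')
... | tri< c<c' _ _ = ⊥-elim (<-irrefl refl (blocks-ordered inc c c' end start' c<c'))
... | tri≈ _ c≡c' _ = toℕ-injective c≡c'
... | tri> _ _ c'<c = ⊥-elim (<-irrefl refl (blocks-ordered inc c' c end' start c'<c))

-- Every point between the first entry and the sentinel lies in some block.
-- (Scan the list for the last entry ≤ x; no ordering is needed for this.)
locate : ∀ {d} a L {x} → a ≤ x → x < d → ∃ λ c → InBlock d (a ∷ L) c x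
locate a []      a≤x x<d = fzero , a≤x , x<d
locate a (b ∷ L) {x} a≤x x<d with b ≤? x
... | yes b≤x = let (c , inBlock) = locate b L b≤x x<d in fsuc c , inBlock
... | no  b≰x = fzero , a≤x , ≰⇒> b≰x

block-exists : ∀ {d L} → Increasing L → (j : Fin (length L)) {x : ℕ} →
  lookup L j ≤ x → x < d → ∃ λ c → InBlock d L c x
block-exists {L = a ∷ L} inc j yj≤x x<d =
  locate a L (≤-trans (lookup-mono inc fzero j z≤n) yj≤x) x<d

ReflectsOrder : {n : ℕ} → (Fin n → ℕ) → Set
ReflectsOrder {n} w = (i j : Fin n) → w i < w j → toℕ i < toℕ j

module _ {n : ℕ} (w : Fin n → ℕ) where

  nonDecreasing-steps : NonDecreasing w →
    ∀ d (a b : Fin n) → toℕ b ≡ d + toℕ a → w a ≤ w b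
  nonDecreasing-steps nd zero    a b b≡a = ≤-reflexive (cong w (toℕ-injective (sym b≡a)))
  nonDecreasing-steps nd (suc d) a b b≡1+d+a =
    ≤-trans (nonDecreasing-steps nd d a b' b'≡d+a) (nd b' b (trans b≡1+d+a (cong suc (sym b'≡d+a))))
    where
    d+a<n : d + toℕ a < n
    d+a<n = <⇒≤ (subst (_< n) b≡1+d+a (toℕ<n b))
    b' : Fin n
    b' = fromℕ< d+a<n
    b'≡d+a : toℕ b' ≡ d + toℕ a
    b'≡d+a = toℕ-fromℕ< d+a<n

  nonDecreasing⇒monotone : NonDecreasing w →
    (a b : Fin n) → toℕ a ≤ toℕ b → w a ≤ w b
  nonDecreasing⇒monotone nd a b a≤b =
    nonDecreasing-steps nd (toℕ b ∸ toℕ a) a b (sym (m∸n+n≡m a≤b))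

  nonDecreasing⇔reflectsOrder : NonDecreasing w ⇔ ReflectsOrder w
  nonDecreasing⇔reflectsOrder = mk⇔ reflects nonDecreasing
    where
    reflects : NonDecreasing w → ReflectsOrder w
    reflects nd i j wi<wj with toℕ i <? toℕ j
    ... | yes i<j = i<j
    ... | no  i≮j = ⊥-elim (<⇒≱ wi<wj (nonDecreasing⇒monotone nd j i (≮⇒≥ i≮j)))

    nonDecreasing : ReflectsOrder w → NonDecreasing w
    nonDecreasing ro i j j≡1+i with w i ≤? w j
    ... | yes wi≤wj = wi≤wj
    ... | no  wi≰wj = ⊥-elim (<⇒≱ (ro j i (≰⇒> wi≰wj)) (≤-trans (n≤1+n _) (≤-reflexive (sym j≡1+i))))

decide-∧³ : ∀ {A B C : Set} (a : Dec A) (b : Dec B) (c : Dec C) →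
  (⌊ a ⌋ ∧ ⌊ b ⌋ ∧ ⌊ c ⌋) ≡ true ⇔ (A × B × C)
decide-∧³ a b c = mk⇔ (to a b c) (from a b c)
  where
  to : ∀ {A B C : Set} (a : Dec A) (b : Dec B) (c : Dec C) →
    (⌊ a ⌋ ∧ ⌊ b ⌋ ∧ ⌊ c ⌋) ≡ true → A × B × C
  to (yes a) (yes b) (yes c) _ = a , b , c
  to (no _)  _       _       ()
  to (yes _) (no _)  _       ()
  to (yes _) (yes _) (no _)  ()

  from : ∀ {A B C : Set} (a : Dec A) (b : Dec B) (c : Dec C) →
    A × B × C → (⌊ a ⌋ ∧ ⌊ b ⌋ ∧ ⌊ c ⌋) ≡ true
  from (yes _) (yes _) (yes _) _           = refl
  from (no ¬a) _       _       (a , _)     = ⊥-elim (¬a a)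
  from (yes _) (no ¬b) _       (_ , b , _) = ⊥-elim (¬b b)
  from (yes _) (yes _) (no ¬c) (_ , _ , c) = ⊥-elim (¬c c)

module PhiMatrix {n : ℕ} (w : Fin n → ℕ) (inv : InversionTable w) where

  L : List ℕ
  L = distinctEntries w

  k : ℕ
  k = numDistinct w

  y : Fin k → ℕ
  y = yval w

  occurs? : (v : ℕ) → Dec (∃ λ m → w m ≡ v)
  occurs? v = any? (λ m → w m ≟ v)

  increasing : Increasing L
  increasing = AllPairs.filter⁺ occurs? (AllPairs.applyUpTo⁺₁ id n (λ i<j _ → i<j))

  bounded : All (_< n) L
  bounded = All-filter⁺ occurs? (all-upTo n)

  -- Every value of w is some y_r, since x_ℓ ≤ ℓ - 1 < n ...
  rank : (m : Fin n) → ∃ λ r → w m ≡ y r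
  rank m = Any.index wm∈L , lookup-index wm∈L
    where
    wm∈L : w m List.∈ L
    wm∈L = ∈-filter⁺ occurs? (∈-upTo⁺ (≤-<-trans (inv m) (toℕ<n m))) (m , refl)

  attained : (r : Fin k) → ∃ λ m → w m ≡ y r
  attained r = proj₂ (∈-filter⁻ occurs? {xs = upTo n} (∈-lookup {xs = L} r))

  Entry : Fin n → Fin k → Fin k → Set
  Entry m r c = w m ≡ y r × InBlock n L c (toℕ m)

  ∈Φ⇔Entry : ∀ {m r c} → m ∈ Φ w r c ⇔ Entry m r c
  ∈Φ⇔Entry {m} {r} {c} = mk⇔
    (λ m∈ → entry (Equivalence.to decide (trans (sym (lookup∘tabulate _ m)) ([]=⇒lookup m∈))))
    (λ e → lookup⇒[]= m (Φ w r c) (trans (lookup∘tabulate _ m) (Equivalence.from decide (conditions e))))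
    where
    Tests : Set
    Tests = w m ≡ y r × y c < suc (toℕ m) × suc (toℕ m) ≤ ynext w c
    decide : (⌊ w m ≟ y r ⌋ ∧ ⌊ y c <? suc (toℕ m) ⌋ ∧ ⌊ suc (toℕ m) ≤? ynext w c ⌋) ≡ true ⇔ Tests
    decide = decide-∧³ (w m ≟ y r) (y c <? suc (toℕ m)) (suc (toℕ m) ≤? ynext w c)
    entry : Tests → Entry m r c
    entry (wm≡yr , yc<1+m , m<end) = wm≡yr , ≤-pred yc<1+m , m<end
    conditions : Entry m r c → Tests
    conditions (wm≡yr , yc≤m , m<end) = wm≡yr , s≤s yc≤m , m<end

  ∈Φ⁻ : ∀ {m r c} → m ∈ Φ w r c → Entry m r c
  ∈Φ⁻ = Equivalence.to ∈Φ⇔Entry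

  ∈Φ⁺ : ∀ {m r c} → Entry m r c → m ∈ Φ w r c
  ∈Φ⁺ = Equivalence.from ∈Φ⇔Entry

  column : ∀ m r → w m ≡ y r → ∃ λ c → m ∈ Φ w r c
  column m r wm≡yr =
    let (c , inBlock) = block-exists increasing r (subst (_≤ toℕ m) wm≡yr (inv m)) (toℕ<n m)
    in c , ∈Φ⁺ (wm≡yr , inBlock)

  upperTriangular : UpperTriangular (Φ w)
  upperTriangular r c c<r = Empty-unique λ { (m , m∈) → below-diagonal (∈Φ⁻ m∈) }
    where
    -- ℓ - 1 < y_r would follow from c < r, but x_ℓ = y_r ≤ ℓ - 1.
    below-diagonal : ∀ {m} → Entry m r c → ⊥
    below-diagonal {m} (wm≡yr , _ , m<end) =
      <⇒≱ (blocks-ordered increasing c r m<end ≤-refl c<r) (subst (_≤ toℕ m) wm≡yr (inv m))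

  rowsNonempty : (r : Fin k) → ∃ λ c → Nonempty (Φ w r c)
  rowsNonempty r = let (m , wm≡yr) = attained r ; (c , m∈) = column m r wm≡yr in c , m , m∈

  -- Column c contains ℓ = y_c + 1, the first point of block c.
  colsNonempty : (c : Fin k) → ∃ λ r → Nonempty (Φ w r c)
  colsNonempty c = r , m , ∈Φ⁺ (wm≡yr , ≤-reflexive (sym m≡yc) , subst (_< next n L c) (sym m≡yc) yc<end)
    where
    yc<end : y c < next n L c
    yc<end = lookup<next increasing bounded c
    yc<n : y c < n
    yc<n = <-≤-trans yc<end (nthOr≤sentinel bounded _)
    m : Fin n
    m = fromℕ< yc<n
    m≡yc : toℕ m ≡ y c
    m≡yc = toℕ-fromℕ< yc<n
    r : Fin k
    r = proj₁ (rank m)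
    wm≡yr : w m ≡ y r
    wm≡yr = proj₂ (rank m)

  partitions : Partitions (Φ w)
  partitions = cover , unique
    where
    cover : (ℓ : Fin n) → ∃ λ r → ∃ λ c → ℓ ∈ Φ w r c
    cover ℓ = let (r , wℓ≡yr) = rank ℓ ; (c , ℓ∈) = column ℓ r wℓ≡yr in r , c , ℓ∈
    unique : (ℓ : Fin n) (r c r' c' : Fin k) → ℓ ∈ Φ w r c → ℓ ∈ Φ w r' c' → (r ≡ r') × (c ≡ c')
    unique ℓ r c r' c' ℓ∈ ℓ∈' with ∈Φ⁻ ℓ∈ | ∈Φ⁻ ℓ∈'
    ... | wℓ≡yr , inBlock | wℓ≡yr' , inBlock' =
      lookup-injective increasing r r' (trans (sym wℓ≡yr) wℓ≡yr') ,
      block-unique increasing c c' inBlock inBlock'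

  colMonotone : ColMonotone (Φ w)
  colMonotone i j r c r' c' i∈ j∈ c<c' with ∈Φ⁻ i∈ | ∈Φ⁻ j∈
  ... | _ , _ , i<end | _ , yc'≤j , _ = blocks-ordered increasing c c' i<end yc'≤j c<c'

  isPartitionMatrix : IsPartitionMatrix (Φ w)
  isPartitionMatrix =
    upperTriangular , (rowsNonempty , colsNonempty) , partitions , colMonotone

  -- Rows are ranks of values, so (iv) says exactly that w reflects order.
  rowMonotone⇔reflectsOrder : RowMonotone (Φ w) ⇔ ReflectsOrder w
  rowMonotone⇔reflectsOrder = mk⇔ reflects rowMonotone
    where
    reflects : RowMonotone (Φ w) → ReflectsOrder w
    reflects rm i j wi<wj =
      let (r , wi≡yr) = rank i ; (c , i∈) = column i r wi≡yr
          (r' , wj≡yr') = rank j ; (c' , j∈) = column j r' wj≡yr'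
      in rm i j r c r' c' i∈ j∈
           (lookup-reflects-< increasing r r' (subst₂ _<_ wi≡yr wj≡yr' wi<wj))

    rowMonotone : ReflectsOrder w → RowMonotone (Φ w)
    rowMonotone ro i j r c r' c' i∈ j∈ r<r' with ∈Φ⁻ i∈ | ∈Φ⁻ j∈
    ... | wi≡yr , _ | wj≡yr' , _ =
      ro i j (subst₂ _<_ (sym wi≡yr) (sym wj≡yr') (lookup-strict increasing r r' r<r'))

-- Φ(w) is always a partition matrix, so Φ(w) ∈ Mono_n reduces to (iv),
-- which is equivalent to w reflecting order, i.e. to w being non-decreasing.
theorem8 : (n : ℕ) (w : Fin n → ℕ) → InversionTable w →
    (IsMono (Φ w) ⇔ NonDecreasing w)
theorem8 n w inv = mk⇔
  (λ (_ , rowMono) → from (nonDecreasing⇔reflectsOrder w) (to rowMonotone⇔reflectsOrder rowMono))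
  (λ nd → isPartitionMatrix , from rowMonotone⇔reflectsOrder (to (nonDecreasing⇔reflectsOrder w) nd))
  where
  open PhiMatrix w inv
  open Equivalence
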